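{- For every rule schema $\gamma_1,\dots,\gamma_m/\varphi$ of $\mathsf{R}'_{\mathrm{BK}}$ other than (1$\star$) $p,\neg p/q$ (including the $\lor$-lifted rules that are themselves primitive), and every propositional variable $s$ not occurring in it, $s\lor\gamma_1,\dots,s\lor\gamma_m\vdash_{\mathsf{R}'_{\mathrm{BK}}}s\lor\varphi$; i.e. its $\lor$-lifted version is derivable in $\mathsf{R}'_{\mathrm{BK}}$.
   Context: Formulas are built from a countably infinite set of variables with binary $\land,\lor$ and unary $\neg$. Set-Fmla Hilbert systems: rule schemas $\gamma_1,\dots,\gamma_m/\varphi$ with all substitution instances; $\Gamma\vdash_{\mathsf R}\varphi$ iff some finite sequence ending in $\varphi$ has each member in $\Gamma$ or the conclusion of a rule instance whose premises occur earlier. The $\lor$-lifted version of a rule $\gamma_1,\dots,\gamma_m/\varphi$ is $s\lor\gamma_1,\dots,s\lor\gamma_m/s\lor\varphi$ with $s$ a variable not occurring in the rule. $\mathsf{R}'_{\mathrm{BK}}$ has rule schemas ($p,q,r$ distinct): (1$\star$) $p,\neg p/q$; (2) $p/\neg\neg p$; (3) $\neg\neg p/p$; (4) $p,q/p\land q$; (5) $\neg p,\neg q/\neg(p\land q)$; (6) $\neg p,q/\neg(p\land q)$; (7) $p,\neg q/\neg(p\land q)$; (8$\star$) $\neg(p\land q)/\neg p\lor p$; (9$\star$) $\neg(p\land q)/\neg q\lor q$; (10) $p\land q/p$; (11) $p\land q/q$; (12) $\neg p,\neg q/\neg(p\lor q)$; (13) $\neg(p\lor q)/\neg p$; (14) $\neg(p\lor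 q)/\neg q$; (15$\star$) $p\lor q/p\lor\neg p$; (16$\star$) $p\lor q/q\lor\neg q$; (17) $\neg p,q/p\lor q$; (18) $p,\neg q/p\lor q$; (19) $p,q/p\lor q$; (20) $p\lor q,\neg p/q$; (21) $p\lor(q\lor r)/(p\lor q)\lor r$; (22) $p\lor p/p$; (23) $p\lor q/q\lor p$; (24) $p\lor q,r/\neg p\lor r$; plus the $\lor$-lifted versions of all these except (1$\star$). -}

module Defs where

open import Data.Nat using (ℕ)
open import Data.List using (List; []; _∷_; map)
open import Data.List.Membership.Propositional using (_∈_)
open import Data.List.Relation.Unary.All using (All)
open import Data.List.Relation.Unary.Any using (Any)
open import Data.Product using (Σ; ∃; _×_)
open import Data.Sum using (_⊎_)
open import Relation.Binary.PropositionalEquality using (_≡_; _≢_)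

infixr 6 _∧_
infixr 5 _∨_
infix 8 ¬_
infix 2 _⟹_
infix 1 _⊢_

data Fmla : Set where
  var : ℕ → Fmla
  _∧_ : Fmla → Fmla → Fmla
  _∨_ : Fmla → Fmla → Fmla
  ¬_  : Fmla → Fmla

sub : (ℕ → Fmla) → Fmla → Fmla
sub σ (var n) = σ n
sub σ (φ ∧ ψ) = sub σ φ ∧ sub σ ψ
sub σ (φ ∨ ψ) = sub σ φ ∨ sub σ ψ
sub σ (¬ φ)   = ¬ sub σ φ

data Occurs (s : ℕ) : Fmla → Set where
  here : Occurs s (var s)
  ∧l : ∀ {φ ψ} → Occurs s φ → Occurs s (φ ∧ ψ)
  ∧r : ∀ {φ ψ} → Occurs s ψ → Occurs s (φ ∧ ψ)
  ∨l : ∀ {φ ψ} → Occurs s φ → Occurs s (φ ∨ ψ)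
  ∨r : ∀ {φ ψ} → Occurs s ψ → Occurs s (φ ∨ ψ)
  ¬i : ∀ {φ} → Occurs s φ → Occurs s (¬ φ)

record Rule : Set where
  constructor _⟹_
  field
    prems : List Fmla
    concl : Fmla
open Rule public

OccursRule : ℕ → Rule → Set
OccursRule s r = Any (Occurs s) (prems r) ⊎ Occurs s (concl r)

liftRule : ℕ → Rule → Rule
liftRule s r = map (λ γ → var s ∨ γ) (prems r) ⟹ (var s ∨ concl r)

p q r : Fmla
p = var 0
q = var 1
r = var 2

data BaseName : Set where
  r1 r2 r3 r4 r5 r6 r7 r8 r9 r10 r11 r12 : BaseName
  r13 r14 r15 r16 r17 r18 r19 r20 r21 r22 r23 r24 : BaseName

baseRule : BaseName → Rule
baseRule r1  = (p ∷ ¬ p ∷ []) ⟹ q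
baseRule r2  = (p ∷ []) ⟹ ¬ ¬ p
baseRule r3  = (¬ ¬ p ∷ []) ⟹ p
baseRule r4  = (p ∷ q ∷ []) ⟹ (p ∧ q)
baseRule r5  = (¬ p ∷ ¬ q ∷ []) ⟹ ¬ (p ∧ q)
baseRule r6  = (¬ p ∷ q ∷ []) ⟹ ¬ (p ∧ q)
baseRule r7  = (p ∷ ¬ q ∷ []) ⟹ ¬ (p ∧ q)
baseRule r8  = (¬ (p ∧ q) ∷ []) ⟹ (¬ p ∨ p)
baseRule r9  = (¬ (p ∧ q) ∷ []) ⟹ (¬ q ∨ q)
baseRule r10 = ((p ∧ q) ∷ []) ⟹ p
baseRule r11 = ((p ∧ q) ∷ []) ⟹ q
baseRule r12 = (¬ p ∷ ¬ q ∷ []) ⟹ ¬ (p ∨ q)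
baseRule r13 = (¬ (p ∨ q) ∷ []) ⟹ ¬ p
baseRule r14 = (¬ (p ∨ q) ∷ []) ⟹ ¬ q
baseRule r15 = ((p ∨ q) ∷ []) ⟹ (p ∨ ¬ p)
baseRule r16 = ((p ∨ q) ∷ []) ⟹ (q ∨ ¬ q)
baseRule r17 = (¬ p ∷ q ∷ []) ⟹ (p ∨ q)
baseRule r18 = (p ∷ ¬ q ∷ []) ⟹ (p ∨ q)
baseRule r19 = (p ∷ q ∷ []) ⟹ (p ∨ q)
baseRule r20 = ((p ∨ q) ∷ ¬ p ∷ []) ⟹ q
baseRule r21 = ((p ∨ (q ∨ r)) ∷ []) ⟹ ((p ∨ q) ∨ r)
baseRule r22 = ((p ∨ p) ∷ []) ⟹ p
baseRule r23 = ((p ∨ q) ∷ []) ⟹ (q ∨ p)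
baseRule r24 = ((p ∨ q) ∷ r ∷ []) ⟹ (¬ p ∨ r)

-- The lifting variable for
-- the primitive lifted rules is var 3, which does not occur in any base rule.
data RName : Set where
  base : BaseName → RName
  lifted : (b : BaseName) → b ≢ r1 → RName

rule : RName → Rule
rule (base b) = baseRule b
rule (lifted b _) = liftRule 3 (baseRule b)

InRBK : Rule → Set
InRBK ρ = Σ RName (λ n → rule n ≡ ρ)

Justified : List Fmla → List Fmla → Fmla → Set
Justified Γ prev φ =
  φ ∈ Γ ⊎
  Σ RName (λ n → Σ (ℕ → Fmla) (λ σ →
    (sub σ (concl (rule n)) ≡ φ) × All (λ γ → sub σ γ ∈ prev) (prems (rule n))))

-- A derivation sequence from Γ, stored in REVERSE order (head = last member).
data DerivSeq (Γ : List Fmla) : List Fmla → Set where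
  []  : DerivSeq Γ []
  _▷_ : ∀ {prev φ} → DerivSeq Γ prev → Justified Γ prev φ → DerivSeq Γ (φ ∷ prev)

_⊢_ : List Fmla → Fmla → Set
Γ ⊢ φ = Σ (List Fmla) (λ prev → DerivSeq Γ (φ ∷ prev))

-- Proof idea: the primitive lifted rules of R'_BK lift by the schematic variable 3, so
-- instantiating 3 with var s (and p, q, r with themselves) yields the lifted version of a base
-- rule for any s. A primitive lifted rule ρ' = 3 ∨ ρ is handled by reassociating each premise
-- s ∨ (3 ∨ γ) to (s ∨ 3) ∨ γ with (21), applying ρ' with 3 instantiated by s ∨ 3, and moving
-- the parentheses back with (21) and (23).
module Submission where

open import Defs
open import Data.Nat using (ℕ)
open import Data.List using (List; []; _∷_; map; _++_)
open import Data.List.Properties using (map-∘)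
open import Data.List.Membership.Propositional using (_∈_)
open import Data.List.Membership.Propositional.Properties using (∈-++⁺ˡ; ∈-++⁺ʳ)
open import Data.List.Relation.Unary.All as All using (All; []; _∷_)
open import Data.List.Relation.Unary.All.Properties using (map⁺; map⁻)
open import Data.List.Relation.Unary.Any using (here)
open import Data.Empty using (⊥)
open import Data.Product using (Σ; _×_; _,_)
open import Data.Sum using (inj₁; inj₂)
open import Function using (_∘_)
open import Relation.Binary.PropositionalEquality using (_≡_; _≢_; refl; sym; cong; trans)

Justified-++ : ∀ {Γ xs ys φ} → Justified Γ xs φ → Justified Γ (xs ++ ys) φ
Justified-++ (inj₁ φ∈Γ) = inj₁ φ∈Γ
Justified-++ (inj₂ (n , σ , eq , prems∈)) = inj₂ (n , σ , eq , All.map ∈-++⁺ˡ prems∈)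

DerivSeq-++ : ∀ {Γ xs ys} → DerivSeq Γ xs → DerivSeq Γ ys → DerivSeq Γ (ys ++ xs)
DerivSeq-++ dxs []         = dxs
DerivSeq-++ dxs (dys ▷ j) = DerivSeq-++ dxs dys ▷ Justified-++ j

DerivSeq-containing : ∀ {Γ φs} → All (Γ ⊢_) φs →
  Σ (List Fmla) (λ seq → DerivSeq Γ seq × All (_∈ seq) φs)
DerivSeq-containing [] = [] , [] , []
DerivSeq-containing ((prev , d) ∷ ds) with DerivSeq-containing ds
... | seq , dseq , φs∈seq =
  _ , DerivSeq-++ dseq d , here refl ∷ All.map (∈-++⁺ʳ (_ ∷ prev)) φs∈seq

∈⇒⊢ : ∀ {Γ φ} → φ ∈ Γ → Γ ⊢ φ
∈⇒⊢ φ∈Γ = [] , ([] ▷ inj₁ φ∈Γ)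

premises-derivable : (Γ : List Fmla) → All (Γ ⊢_) Γ
premises-derivable Γ = All.tabulate ∈⇒⊢

subRule : (ℕ → Fmla) → Rule → Rule
subRule σ ρ = map (sub σ) (prems ρ) ⟹ sub σ (concl ρ)

Instance : Rule → Set
Instance ρ = Σ RName (λ n → Σ (ℕ → Fmla) (λ σ → subRule σ (rule n) ≡ ρ))

instance-closed : ∀ {Γ ρ} → Instance ρ → All (Γ ⊢_) (prems ρ) → Γ ⊢ concl ρ
instance-closed (n , σ , refl) ds with DerivSeq-containing ds
... | seq , dseq , prems∈seq = seq , (dseq ▷ inj₂ (n , σ , refl , map⁻ prems∈seq))

instance-derivable : ∀ {ρ} → Instance ρ → prems ρ ⊢ concl ρ
instance-derivable inst = instance-closed inst (premises-derivable _)

pqr≔ : Fmla → Fmla → Fmla → ℕ → Fmla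
pqr≔ a b c 0 = a
pqr≔ a b c 1 = b
pqr≔ a b c 2 = c
pqr≔ a b c n = var n

∨-comm : ∀ {Γ a b} → Γ ⊢ a ∨ b → Γ ⊢ b ∨ a
∨-comm {a = a} {b} d = instance-closed (base r23 , pqr≔ a b r , refl) (d ∷ [])

∨-assocˡ : ∀ {Γ a b c} → Γ ⊢ a ∨ (b ∨ c) → Γ ⊢ (a ∨ b) ∨ c
∨-assocˡ {a = a} {b} {c} d = instance-closed (base r21 , pqr≔ a b c , refl) (d ∷ [])

∨-assocʳ : ∀ {Γ a b c} → Γ ⊢ (a ∨ b) ∨ c → Γ ⊢ a ∨ (b ∨ c)
∨-assocʳ = ∨-comm ∘ ∨-assocˡ ∘ ∨-comm ∘ ∨-assocˡ ∘ ∨-comm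

liftBy : Fmla → Rule → Rule
liftBy t ρ = map (t ∨_) (prems ρ) ⟹ (t ∨ concl ρ)

subRule-liftBy : ∀ σ t ρ → subRule σ (liftBy t ρ) ≡ liftBy (sub σ t) (subRule σ ρ)
subRule-liftBy σ t ρ =
  cong (_⟹ (sub σ t ∨ sub σ (concl ρ))) (trans (sym (map-∘ (prems ρ))) (map-∘ (prems ρ)))

var3≔ : Fmla → ℕ → Fmla
var3≔ t 3 = t
var3≔ t n = var n

subRule-var3≔-baseRule : ∀ t b → subRule (var3≔ t) (baseRule b) ≡ baseRule b
subRule-var3≔-baseRule t r1  = refl
subRule-var3≔-baseRule t r2  = refl
subRule-var3≔-baseRule t r3  = refl
subRule-var3≔-baseRule t r4  = refl
subRule-var3≔-baseRule t r5  = refl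
subRule-var3≔-baseRule t r6  = refl
subRule-var3≔-baseRule t r7  = refl
subRule-var3≔-baseRule t r8  = refl
subRule-var3≔-baseRule t r9  = refl
subRule-var3≔-baseRule t r10 = refl
subRule-var3≔-baseRule t r11 = refl
subRule-var3≔-baseRule t r12 = refl
subRule-var3≔-baseRule t r13 = refl
subRule-var3≔-baseRule t r14 = refl
subRule-var3≔-baseRule t r15 = refl
subRule-var3≔-baseRule t r16 = refl
subRule-var3≔-baseRule t r17 = refl
subRule-var3≔-baseRule t r18 = refl
subRule-var3≔-baseRule t r19 = refl
subRule-var3≔-baseRule t r20 = refl
subRule-var3≔-baseRule t r21 = refl
subRule-var3≔-baseRule t r22 = refl
subRule-var3≔-baseRule t r23 = refl
subRule-var3≔-baseRule t r24 = refl

liftBy-baseRule-instance : ∀ b → b ≢ r1 → (t : Fmla) → Instance (liftBy t (baseRule b))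
liftBy-baseRule-instance b b≢r1 t =
  lifted b b≢r1 , var3≔ t ,
  trans (subRule-liftBy (var3≔ t) (var 3) (baseRule b)) (cong (liftBy t) (subRule-var3≔-baseRule t b))

liftBy-liftBy-derivable : ∀ {ρ} → (∀ t → Instance (liftBy t ρ)) →
  ∀ s u → prems (liftBy s (liftBy u ρ)) ⊢ concl (liftBy s (liftBy u ρ))
liftBy-liftBy-derivable {ρ} inst s u =
  ∨-assocʳ (instance-closed (inst (s ∨ u)) (map⁺ (All.map ∨-assocˡ (map⁻ (map⁻ hyps)))))
  where
  hyps : All (prems (liftBy s (liftBy u ρ)) ⊢_) (prems (liftBy s (liftBy u ρ)))
  hyps = premises-derivable (prems (liftBy s (liftBy u ρ)))

lemma3 : (n : RName) → n ≢ base r1 → (s : ℕ) → (OccursRule s (rule n) → ⊥) →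
    map (λ γ → var s ∨ γ) (prems (rule n)) ⊢ (var s ∨ concl (rule n))
lemma3 (base b) base-b≢r1 s _ =
  instance-derivable (liftBy-baseRule-instance b (base-b≢r1 ∘ cong base) (var s))
lemma3 (lifted b b≢r1) _ s _ =
  liftBy-liftBy-derivable (liftBy-baseRule-instance b b≢r1) (var s) (var 3)
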